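{- Let $n\ge4$ and let $\Gamma$ be a simple connected graph on vertex set $\{2,\dots,n\}$, viewed as a subgraph of the complete graph $K_{n-1}$ on the same vertices. The restriction map $\pi_\Gamma:F\mapsto F\cap E(\Gamma)$ is injective on the set of $\Gamma$-stable flats of $K_{n-1}$ (equivalently, on the cones corresponding to $\Gamma$-stable flats) if and only if $\Gamma$ is a complete multipartite graph.
   Context: Flats of the cycle matroid of $K_{n-1}$ are exactly the edge sets of cluster graphs $\coprod_{j=1}^d K_{I_j}$, with $I_j\subseteq\{2,\dots,n\}$ pairwise disjoint of size $\ge2$ and $K_I$ the complete graph on $I$. Such a flat is $\Gamma$-stable if each $K_{I_j}$ contains at least one edge of $\Gamma$ (equivalently, the tropical curve with a root vertex carrying end $1$ and the labels outside $\bigcup I_j$, joined by $d$ bounded edges to vertices $v_j$ carrying ends $I_j$, is $\Gamma$-stable). The map $\pi_\Gamma$ is the projection $\mathbb{R}^{|E(K_{n-1})|}/L\to\mathbb{R}^{|E(K_{n-1})|}/L/\mathrm{span}\{v_e:e\notin E(\Gamma)\}$, $L=\mathbb{R}(1,\dots,1)$, acting on flats as $F\mapsto F\cap E(\Gamma)$. A complete multipartite graph is one whose vertex set is partitioned into independent sets with two vertices adjacent iff they lie in different parts. -}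

module Defs where

open import Data.Nat using (ℕ; _≤_)
open import Data.Fin using (Fin)
open import Data.Fin.Subset using (Subset; _∈_; ∣_∣)
open import Data.Bool using (Bool; true; false)
open import Data.Product using (Σ; ∃; ∃-syntax; _×_)
open import Function.Bundles using (_⇔_)
open import Function.Definitions using (Surjective)
open import Relation.Binary.PropositionalEquality using (_≡_; _≢_)
open import Relation.Binary.Construct.Closure.ReflexiveTransitive using (Star)

-- Convention: the vertex set {2,…,n} (of size n-1) is encoded as Fin (n ∸ 1),
-- vertex i : Fin (n ∸ 1) standing for the label i + 2.

record SimpleGraph (m : ℕ) : Set where
  field
    adj    : Fin m → Fin m → Bool
    sym    : ∀ i j → adj i j ≡ adj j i
    irrefl : ∀ i → adj i i ≡ false
open SimpleGraph public

Edge : ∀ {m} → SimpleGraph m → Fin m → Fin m → Set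
Edge Γ i j = adj Γ i j ≡ true

Connected : ∀ {m} → SimpleGraph m → Set
Connected Γ = ∀ i j → Star (Edge Γ) i j

-- Data of a cluster graph ∐_{k<d} K_{I_k}: pairwise disjoint I_k ⊆ V of size ≥ 2.
record ClusterData (m : ℕ) : Set where
  field
    d        : ℕ
    I        : Fin d → Subset m
    disjoint : ∀ k l (x : Fin m) → x ∈ I k → x ∈ I l → k ≡ l
    big      : ∀ k → 2 ≤ ∣ I k ∣
open ClusterData public

-- The edge set of the cluster graph (= the corresponding flat of M(K_m)):
-- {i,j} (i ≠ j) lies in the flat iff i, j lie in a common block I_k.
InFlat : ∀ {m} → ClusterData m → Fin m → Fin m → Set
InFlat F i j = i ≢ j × ∃[ k ] (i ∈ I F k × j ∈ I F k)

Stable : ∀ {m} → SimpleGraph m → ClusterData m → Set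
Stable Γ F = ∀ k → ∃[ i ] ∃[ j ] (i ∈ I F k × j ∈ I F k × Edge Γ i j)

SameFlat : ∀ {m} → ClusterData m → ClusterData m → Set
SameFlat F G = ∀ i j → InFlat F i j ⇔ InFlat G i j

SameRestriction : ∀ {m} → SimpleGraph m → ClusterData m → ClusterData m → Set
SameRestriction Γ F G = ∀ i j → Edge Γ i j → (InFlat F i j ⇔ InFlat G i j)

PiInjectiveOnStable : ∀ {m} → SimpleGraph m → Set
PiInjectiveOnStable Γ =
  ∀ F G → Stable Γ F → Stable Γ G → SameRestriction Γ F G → SameFlat F G

CompleteMultipartite : ∀ {m} → SimpleGraph m → Set
CompleteMultipartite {m} Γ =
  Σ ℕ λ p → Σ (Fin m → Fin p) λ part →
    Surjective _≡_ _≡_ part × (∀ i j → Edge Γ i j ⇔ part i ≢ part j)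

module Submission where

-- Write i ≁ j for "i and j are not adjacent in Γ" (this holds
-- for i = j).  Γ is complete multipartite exactly when ≁ is an equivalence
-- relation, i.e. when ≁ is transitive: the parts are then its classes.  So the
-- theorem is the equivalence
--     π_Γ injective on Γ-stable flats  ⇔  ≁ is transitive.
-- (⇐) If ≁ is transitive, any two non-adjacent vertices i, j of a block of a
--     Γ-stable flat F have a common neighbour x in that block (take an edge of Γ
--     inside the block); the Γ-edges ix and jx of F are then recorded by π_Γ(F)
--     and force i and j into one block of every flat with the same restriction.
-- (⇒) If a ≁ b ≁ c but ac ∈ E(Γ), the one-block flats K_{abc} and K_{ac} are
--     Γ-stable and have the same restriction (b has no Γ-neighbour in {a, c}),
--     yet only the first contains ab.

open import Defs hiding (sym)
open import Data.Nat using (ℕ; zero; suc; _≤_; _∸_; z≤n; s≤s)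
open import Data.Bool using (true; false)
open import Data.Bool.Properties using () renaming (_≟_ to _≟ᵇ_)
open import Data.Fin using (Fin; zero; suc)
open import Data.Fin.Properties using (any?; suc-injective) renaming (_≟_ to _≟ᶠ_)
open import Data.Fin.Subset using (Subset; _∈_; _∉_; ∣_∣; ⁅_⁆; _∪_; inside; outside)
open import Data.Fin.Subset.Properties using (x∈⁅x⁆; x∈⁅y⁆⇒x≡y; p⊆p∪q; q⊆p∪q; x∈p∪q⁻)
open import Data.Vec.Base using (_∷_; here; there)
open import Data.Product using (∃-syntax; _×_; _,_)
open import Data.Sum using (_⊎_; inj₁; inj₂; [_,_])
open import Data.Empty using (⊥-elim)
open import Function.Base using (_∘_; _on_)
open import Function.Bundles using (_⇔_; mk⇔; Equivalence)
open import Function.Definitions using (Surjective)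
open import Level using (Level)
open import Relation.Nullary using (¬_; Dec; yes; no)
open import Relation.Nullary.Decidable using (decidable-stable)
open import Relation.Binary.Structures using (IsEquivalence; IsDecEquivalence)
open import Relation.Binary.PropositionalEquality using (_≡_; _≢_; refl; sym; trans; cong; subst)
import Relation.Binary.Construct.On as On
open Equivalence

member⇒1≤∣p∣ : ∀ {m} {x : Fin m} {p : Subset m} → x ∈ p → 1 ≤ ∣ p ∣
member⇒1≤∣p∣ {p = inside ∷ p} here = s≤s z≤n
member⇒1≤∣p∣ {p = inside ∷ p} (there x∈p) = s≤s z≤n
member⇒1≤∣p∣ {p = outside ∷ p} (there x∈p) = member⇒1≤∣p∣ x∈p

twoMembers⇒2≤∣p∣ : ∀ {m} {x y : Fin m} {p : Subset m} → x ∈ p → y ∈ p → x ≢ y → 2 ≤ ∣ p ∣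
twoMembers⇒2≤∣p∣ here here x≢y = ⊥-elim (x≢y refl)
twoMembers⇒2≤∣p∣ {p = inside ∷ p} here (there y∈p) _ = s≤s (member⇒1≤∣p∣ y∈p)
twoMembers⇒2≤∣p∣ {p = inside ∷ p} (there x∈p) _ _ = s≤s (member⇒1≤∣p∣ x∈p)
twoMembers⇒2≤∣p∣ {p = outside ∷ p} (there x∈p) (there y∈p) x≢y =
  twoMembers⇒2≤∣p∣ x∈p y∈p (x≢y ∘ cong suc)

record Classification {ℓ : Level} (m : ℕ) (_≈_ : Fin m → Fin m → Set ℓ) : Set ℓ where
  field
    classes    : ℕ
    class      : Fin m → Fin classes
    surjective : Surjective _≡_ _≡_ class
    sameClass  : ∀ i j → class i ≡ class j ⇔ i ≈ j

module _ {ℓ : Level} {m : ℕ} {_≈_ : Fin (suc m) → Fin (suc m) → Set ℓ}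
         (isEquivalence : IsEquivalence _≈_) where
  open IsEquivalence isEquivalence renaming (refl to ≈-refl; sym to ≈-sym; trans to ≈-trans)

  joinClass : (t : Fin m) → zero ≈ suc t → Classification m (_≈_ on suc) → Classification (suc m) _≈_
  joinClass t 0≈t C = record { classes = classes ; class = class′ ; surjective = surjective′ ; sameClass = same }
    where
    open Classification C
    class′ : Fin (suc m) → Fin classes
    class′ zero = class t
    class′ (suc a) = class a
    surjective′ : Surjective _≡_ _≡_ class′
    surjective′ y with surjective y
    ... | x , hit = suc x , λ { refl → hit refl }
    same : ∀ i j → class′ i ≡ class′ j ⇔ i ≈ j
    same zero zero = mk⇔ (λ _ → ≈-refl) (λ _ → refl)
    same zero (suc b) = mk⇔ (≈-trans 0≈t ∘ to (sameClass t b)) (from (sameClass t b) ∘ ≈-trans (≈-sym 0≈t))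
    same (suc a) zero = mk⇔ (λ e → ≈-trans (to (sameClass a t) e) (≈-sym 0≈t)) (λ r → from (sameClass a t) (≈-trans r 0≈t))
    same (suc a) (suc b) = sameClass a b

  newClass : (∀ t → ¬ zero ≈ suc t) → Classification m (_≈_ on suc) → Classification (suc m) _≈_
  newClass 0≉ C = record { classes = suc classes ; class = class′ ; surjective = surjective′ ; sameClass = same }
    where
    open Classification C
    class′ : Fin (suc m) → Fin (suc classes)
    class′ zero = zero
    class′ (suc a) = suc (class a)
    surjective′ : Surjective _≡_ _≡_ class′
    surjective′ zero = zero , λ { refl → refl }
    surjective′ (suc y) with surjective y
    ... | x , hit = suc x , λ { refl → cong suc (hit refl) }
    same : ∀ i j → class′ i ≡ class′ j ⇔ i ≈ j
    same zero zero = mk⇔ (λ _ → ≈-refl) (λ _ → refl)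
    same zero (suc b) = mk⇔ (λ ()) (⊥-elim ∘ 0≉ b)
    same (suc a) zero = mk⇔ (λ ()) (⊥-elim ∘ 0≉ a ∘ ≈-sym)
    same (suc a) (suc b) = mk⇔ (to (sameClass a b) ∘ suc-injective) (cong suc ∘ from (sameClass a b))

classify : ∀ {ℓ} m {_≈_ : Fin m → Fin m → Set ℓ} → IsDecEquivalence _≈_ → Classification m _≈_
classify zero _ = record { classes = 0 ; class = λ () ; surjective = λ () ; sameClass = λ () }
classify (suc m) {_≈_} isDecEq = placeZero (any? (λ t → zero ≟ suc t))
  where
  open IsDecEquivalence isDecEq
  classifySuc : Classification m (_≈_ on suc)
  classifySuc = classify m (On.isDecEquivalence suc isDecEq)
  placeZero : Dec (∃[ t ] zero ≈ suc t) → Classification (suc m) _≈_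
  placeZero (yes (t , 0≈t)) = joinClass isEquivalence t 0≈t classifySuc
  placeZero (no 0≉)         = newClass isEquivalence (λ t 0≈t → 0≉ (t , 0≈t)) classifySuc

singleBlock : ∀ {m} (P : Subset m) → 2 ≤ ∣ P ∣ → ClusterData m
singleBlock P 2≤∣P∣ = record
  { d = 1 ; I = λ _ → P ; disjoint = λ { zero zero _ _ _ → refl } ; big = λ _ → 2≤∣P∣ }

-- Two vertices sharing a block with a third vertex x share a block with each
-- other: the blocks of a flat are disjoint.
InFlat-join : ∀ {m} (G : ClusterData m) {i j x} → i ≢ j → InFlat G i x → InFlat G j x → InFlat G i j
InFlat-join G i≢j (_ , k , i∈k , x∈k) (_ , l , j∈l , x∈l) =
  i≢j , k , i∈k , subst (λ k′ → _ ∈ I G k′) (sym (disjoint G k l _ x∈k x∈l)) j∈l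

module _ {m} (Γ : SimpleGraph m) where

  NonAdjacent : Fin m → Fin m → Set
  NonAdjacent i j = adj Γ i j ≡ false

  NonAdjacencyTransitive : Set
  NonAdjacencyTransitive = ∀ {i j k} → NonAdjacent i j → NonAdjacent j k → NonAdjacent i k

  edge-or-nonAdjacent : ∀ i j → Edge Γ i j ⊎ NonAdjacent i j
  edge-or-nonAdjacent i j with adj Γ i j
  ... | true = inj₁ refl
  ... | false = inj₂ refl

  edge⇒¬nonAdjacent : ∀ {i j} → Edge Γ i j → ¬ NonAdjacent i j
  edge⇒¬nonAdjacent ij i≁j with () ← trans (sym ij) i≁j

  edge⇒distinct : ∀ {i j} → Edge Γ i j → i ≢ j
  edge⇒distinct {i} ij refl = edge⇒¬nonAdjacent ij (irrefl Γ i)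

  nonAdjacent-sym : ∀ {i j} → NonAdjacent i j → NonAdjacent j i
  nonAdjacent-sym {i} {j} i≁j = trans (SimpleGraph.sym Γ j i) i≁j

  edgeInBlock : ∀ (F : ClusterData m) {i j} k → Edge Γ i j → i ∈ I F k → j ∈ I F k → InFlat F i j
  edgeInBlock F k ij i∈k j∈k = edge⇒distinct ij , k , i∈k , j∈k

  -- If ≁ is transitive, every vertex is adjacent to an endpoint of each edge ab
  -- (otherwise a ≁ i ≁ b).
  neighbourOnEdge : NonAdjacencyTransitive → ∀ {a b} → Edge Γ a b → ∀ i → Edge Γ i a ⊎ Edge Γ i b
  neighbourOnEdge trans≁ {a} {b} ab i with edge-or-nonAdjacent i a | edge-or-nonAdjacent i b
  ... | inj₁ ia | _       = inj₁ ia
  ... | inj₂ _  | inj₁ ib = inj₂ ib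
  ... | inj₂ ia | inj₂ ib = ⊥-elim (edge⇒¬nonAdjacent ab (trans≁ (nonAdjacent-sym ia) ib))

  -- If ≁ is transitive, a neighbour x of i is also a neighbour of every j ≁ i
  -- (otherwise i ≁ j ≁ x).
  neighbourShared : NonAdjacencyTransitive → ∀ {i j x} → NonAdjacent i j → Edge Γ i x → Edge Γ j x
  neighbourShared trans≁ {j = j} {x} i≁j ix with edge-or-nonAdjacent j x
  ... | inj₁ jx  = jx
  ... | inj₂ j≁x = ⊥-elim (edge⇒¬nonAdjacent ix (trans≁ i≁j j≁x))

  -- Hence two non-adjacent vertices have a common neighbour among the
  -- endpoints of any edge ab (P records where a and b live).
  commonNeighbour : NonAdjacencyTransitive → ∀ {i j a b} (P : Fin m → Set) → NonAdjacent i j →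
    Edge Γ a b → P a → P b → ∃[ x ] (P x × Edge Γ i x × Edge Γ j x)
  commonNeighbour trans≁ {i} {a = a} {b} P i≁j ab Pa Pb with neighbourOnEdge trans≁ ab i
  ... | inj₁ ia = a , Pa , ia , neighbourShared trans≁ i≁j ia
  ... | inj₂ ib = b , Pb , ib , neighbourShared trans≁ i≁j ib

  -- A non-edge ij of F is covered through a common neighbour x
  -- of i and j inside their block, which exists by stability.
  stableFlat⊆ : NonAdjacencyTransitive → ∀ F G → Stable Γ F →
    (∀ i j → Edge Γ i j → InFlat F i j → InFlat G i j) → ∀ i j → InFlat F i j → InFlat G i j
  stableFlat⊆ trans≁ F G stable F∩E⊆G i j ij@(i≢j , k , i∈k , j∈k) with edge-or-nonAdjacent i j
  ... | inj₁ edge = F∩E⊆G i j edge ij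
  ... | inj₂ i≁j =
    let a , b , a∈k , b∈k , ab = stable k
        x , x∈k , ix , jx      = commonNeighbour trans≁ (λ y → y ∈ I F k) i≁j ab a∈k b∈k
    in InFlat-join G i≢j (F∩E⊆G i x ix (edgeInBlock F k ix i∈k x∈k))
                         (F∩E⊆G j x jx (edgeInBlock F k jx j∈k x∈k))

  transitive⇒injective : NonAdjacencyTransitive → PiInjectiveOnStable Γ
  transitive⇒injective trans≁ F G stableF stableG sameRestriction i j = mk⇔
    (stableFlat⊆ trans≁ F G stableF (λ a b ab → to (sameRestriction a b ab)) i j)
    (stableFlat⊆ trans≁ G F stableG (λ a b ab → from (sameRestriction a b ab)) i j)

  -- (⇒) A path a ≁ b ≁ c of non-edges is never closed by an edge ac when π_Γ is
  -- injective: the one-block flats K_{abc} and K_{ac} would be Γ-stable (via ac)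
  -- with the same restriction (b has no Γ-neighbour in {a, c}), but ab lies in
  -- the first only.
  nonEdgePathNotClosed : PiInjectiveOnStable Γ → ∀ {a b c} →
    NonAdjacent a b → NonAdjacent b c → ¬ Edge Γ a c
  nonEdgePathNotClosed injective {a} {b} {c} a≁b b≁c ac = b∉pair (memberOfPair (to abInFlat abInTriple))
    where
    pair triple : Subset m
    pair = ⁅ a ⁆ ∪ ⁅ c ⁆
    triple = pair ∪ ⁅ b ⁆

    a∈pair : a ∈ pair
    a∈pair = p⊆p∪q ⁅ c ⁆ (x∈⁅x⁆ a)
    c∈pair : c ∈ pair
    c∈pair = q⊆p∪q ⁅ a ⁆ ⁅ c ⁆ (x∈⁅x⁆ c)
    pair⊆triple : ∀ {x} → x ∈ pair → x ∈ triple
    pair⊆triple = p⊆p∪q ⁅ b ⁆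
    b∈triple : b ∈ triple
    b∈triple = q⊆p∪q pair ⁅ b ⁆ (x∈⁅x⁆ b)

    pairMember : ∀ {x} → x ∈ pair → x ≡ a ⊎ x ≡ c
    pairMember x∈pair with x∈p∪q⁻ ⁅ a ⁆ ⁅ c ⁆ x∈pair
    ... | inj₁ x∈a = inj₁ (x∈⁅y⁆⇒x≡y a x∈a)
    ... | inj₂ x∈c = inj₂ (x∈⁅y⁆⇒x≡y c x∈c)

    tripleMember : ∀ {x} → x ∈ triple → x ∈ pair ⊎ x ≡ b
    tripleMember x∈triple with x∈p∪q⁻ pair ⁅ b ⁆ x∈triple
    ... | inj₁ x∈pair = inj₁ x∈pair
    ... | inj₂ x∈b = inj₂ (x∈⁅y⁆⇒x≡y b x∈b)

    b∉pair : b ∉ pair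
    b∉pair b∈pair with pairMember b∈pair
    ... | inj₁ refl = edge⇒¬nonAdjacent ac b≁c
    ... | inj₂ refl = edge⇒¬nonAdjacent ac a≁b

    bIsolatedFromPair : ∀ {y} → y ∈ pair → NonAdjacent b y
    bIsolatedFromPair y∈pair with pairMember y∈pair
    ... | inj₁ refl = nonAdjacent-sym a≁b
    ... | inj₂ refl = b≁c

    edgeInTriple⇒inPair : ∀ {x y} → Edge Γ x y → x ∈ triple → y ∈ triple → x ∈ pair × y ∈ pair
    edgeInTriple⇒inPair xy x∈triple y∈triple with tripleMember x∈triple | tripleMember y∈triple
    ... | inj₁ x∈pair | inj₁ y∈pair = x∈pair , y∈pair
    ... | inj₁ x∈pair | inj₂ refl   = ⊥-elim (edge⇒¬nonAdjacent xy (nonAdjacent-sym (bIsolatedFromPair x∈pair)))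
    ... | inj₂ refl   | inj₁ y∈pair = ⊥-elim (edge⇒¬nonAdjacent xy (bIsolatedFromPair y∈pair))
    ... | inj₂ refl   | inj₂ refl   = ⊥-elim (edge⇒distinct xy refl)

    a≢c : a ≢ c
    a≢c = edge⇒distinct ac

    K-pair K-triple : ClusterData m
    K-pair = singleBlock pair (twoMembers⇒2≤∣p∣ a∈pair c∈pair a≢c)
    K-triple = singleBlock triple (twoMembers⇒2≤∣p∣ (pair⊆triple a∈pair) (pair⊆triple c∈pair) a≢c)

    sameRestriction : SameRestriction Γ K-triple K-pair
    sameRestriction x y xy = mk⇔
      (λ { (x≢y , k , x∈triple , y∈triple) → let x∈pair , y∈pair = edgeInTriple⇒inPair xy x∈triple y∈triple
                                              in x≢y , k , x∈pair , y∈pair })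
      (λ { (x≢y , k , x∈pair , y∈pair) → x≢y , k , pair⊆triple x∈pair , pair⊆triple y∈pair })

    abInFlat : InFlat K-triple a b ⇔ InFlat K-pair a b
    abInFlat = injective K-triple K-pair
      (λ _ → a , c , pair⊆triple a∈pair , pair⊆triple c∈pair , ac)
      (λ _ → a , c , a∈pair , c∈pair , ac)
      sameRestriction a b

    abInTriple : InFlat K-triple a b
    abInTriple = (λ { refl → b∉pair a∈pair }) , zero , pair⊆triple a∈pair , b∈triple

    memberOfPair : InFlat K-pair a b → b ∈ pair
    memberOfPair (_ , _ , _ , b∈pair) = b∈pair

  injective⇒transitive : PiInjectiveOnStable Γ → NonAdjacencyTransitive
  injective⇒transitive injective {i} {j} {k} i≁j j≁k with edge-or-nonAdjacent i k
  ... | inj₁ ik  = ⊥-elim (nonEdgePathNotClosed injective i≁j j≁k ik)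
  ... | inj₂ i≁k = i≁k

  -- In a complete multipartite graph, ≁ is "lying in the same part".
  multipartite⇒transitive : CompleteMultipartite Γ → NonAdjacencyTransitive
  multipartite⇒transitive (_ , part , _ , edge⇔differentParts) i≁j j≁k =
    from (nonAdjacent⇔samePart _ _)
      (trans (to (nonAdjacent⇔samePart _ _) i≁j) (to (nonAdjacent⇔samePart _ _) j≁k))
    where
    nonAdjacent⇔samePart : ∀ i j → NonAdjacent i j ⇔ part i ≡ part j
    nonAdjacent⇔samePart i j = mk⇔
      (λ i≁j → decidable-stable (part i ≟ᶠ part j)
                 (λ different → edge⇒¬nonAdjacent (from (edge⇔differentParts i j) different) i≁j))
      (λ same → [ (λ ij → ⊥-elim (to (edge⇔differentParts i j) ij same)) , (λ i≁j → i≁j) ] (edge-or-nonAdjacent i j))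

  transitive⇒multipartite : NonAdjacencyTransitive → CompleteMultipartite Γ
  transitive⇒multipartite trans≁ = classes , class , surjective , edge⇔differentClasses
    where
    nonAdjacency : IsDecEquivalence NonAdjacent
    nonAdjacency = record
      { isEquivalence = record { refl = irrefl Γ _ ; sym = nonAdjacent-sym ; trans = trans≁ }
      ; _≟_ = λ i j → adj Γ i j ≟ᵇ false }
    open Classification (classify m nonAdjacency)
    edge⇔differentClasses : ∀ i j → Edge Γ i j ⇔ class i ≢ class j
    edge⇔differentClasses i j = mk⇔
      (λ ij same → edge⇒¬nonAdjacent ij (to (sameClass i j) same))
      (λ different → [ (λ ij → ij) , (λ i≁j → ⊥-elim (different (from (sameClass i j) i≁j))) ]
                       (edge-or-nonAdjacent i j))

lemma3p27 : (n : ℕ) → 4 ≤ n → (Γ : SimpleGraph (n ∸ 1)) → Connected Γ →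
    PiInjectiveOnStable Γ ⇔ CompleteMultipartite Γ
lemma3p27 n _ Γ _ = mk⇔
  (transitive⇒multipartite Γ ∘ injective⇒transitive Γ)
  (transitive⇒injective Γ ∘ multipartite⇒transitive Γ)
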